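{- Let $(G,p)$ be a framework in $\mathbb{R}^d$ with $G=(V,E)$, let $\omega$ be an equilibrium stress of $(G,p)$ and let $\Omega$ be the stress matrix associated to $\omega$. Suppose $\operatorname{rank}(\Omega)=1$. Then the edge set $\operatorname{supp}(\omega)=\{e\in E:\omega(e)\ne0\}$ induces a complete graph, i.e. any two vertices that are each incident to some edge of $\operatorname{supp}(\omega)$ are joined by an edge of $\operatorname{supp}(\omega)$.
   Context: A framework in $\mathbb{R}^d$ is a pair $(G,p)$ with $G=(V,E)$ a finite simple graph and $p:V\to\mathbb{R}^d$. The rigidity matrix $R(G,p)$ is the $|E|\times d|V|$ matrix whose row for edge $uv$ has $p(u)-p(v)$ in the $d$ columns of $u$, $p(v)-p(u)$ in the columns of $v$, and zeros elsewhere. An (equilibrium) stress is a vector $\omega\in\mathbb{R}^E$ with $R(G,p)^T\omega=0$. The stress matrix associated to $\omega$ is $\Omega\in\mathbb{R}^{V\times V}$ with $\Omega_{uv}=-\omega_{uv}$ if $uv\in E$, $\Omega_{uu}=\sum_{w:uw\in E}\omega_{uw}$, and $\Omega_{uv}=0$ otherwise. -}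

module Defs where

open import Level using (Level; _⊔_) renaming (suc to lsuc)
open import Data.Nat using (ℕ; zero; suc)
open import Data.Fin using (Fin; zero; suc; _≟_)
open import Data.Bool using (Bool; true; false; if_then_else_)
open import Data.Product using (Σ; ∃; _×_; _,_)
open import Relation.Nullary using (¬_; yes; no)
open import Relation.Binary.PropositionalEquality using (_≡_; _≢_)
open import Algebra.Bundles using (CommutativeRing)

record Field (c ℓ : Level) : Set (lsuc (c ⊔ ℓ)) where
  field
    commutativeRing : CommutativeRing c ℓ
  open CommutativeRing commutativeRing public
  field
    0≉1     : ¬ (0# ≈ 1#)
    inverse : ∀ x → ¬ (x ≈ 0#) → Σ Carrier λ y → (x * y) ≈ 1#

module FieldDefs {c ℓ : Level} (K : Field c ℓ) where
  open Field K using (Carrier; _≈_; _+_; _*_; -_; _-_; 0#; 1#)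

  ∑ : (n : ℕ) → (Fin n → Carrier) → Carrier
  ∑ zero    f = 0#
  ∑ (suc n) f = f zero + ∑ n (λ i → f (suc i))

  record Graph (n : ℕ) : Set where
    field
      adj     : Fin n → Fin n → Bool
      symm    : ∀ u v → adj u v ≡ adj v u
      irrefl  : ∀ u → adj u u ≡ false

  -- A vector indexed by edges ω ∈ K^E is represented by a symmetric function
  -- on pairs of vertices; only its values on edges are used (via edgeVal).
  record EdgeVector {n : ℕ} (G : Graph n) : Set (c ⊔ ℓ) where
    field
      val  : Fin n → Fin n → Carrier
      symm : ∀ u v → val u v ≈ val v u

  module _ {n : ℕ} (G : Graph n) where
    open Graph G

    edgeVal : EdgeVector G → Fin n → Fin n → Carrier
    edgeVal ω u v = if adj u v then EdgeVector.val ω u v else 0#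

    -- R(G,p)^T ω = 0 : the (u,k) entry of R^T ω is
    --   ∑_{v : uv ∈ E} ω(uv) (p(u)_k - p(v)_k)
    IsStress : {d : ℕ} → (p : Fin n → Fin d → Carrier) → EdgeVector G → Set ℓ
    IsStress {d} p ω = ∀ (u : Fin n) (k : Fin d) →
      ∑ n (λ v → edgeVal ω u v * (p u k - p v k)) ≈ 0#

    stressMatrix : EdgeVector G → Fin n → Fin n → Carrier
    stressMatrix ω u v with u ≟ v
    ... | yes _ = ∑ n (λ w → edgeVal ω u w)
    ... | no  _ = - edgeVal ω u v

    InSupport : EdgeVector G → Fin n → Set ℓ
    InSupport ω u = ∃ λ w → adj u w ≡ true × ¬ (EdgeVector.val ω u w ≈ 0#)

  LinIndep : {m k : ℕ} → (Fin k → Fin m → Carrier) → Set (c ⊔ ℓ)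
  LinIndep {m} {k} vs = ∀ (λs : Fin k → Carrier) →
    (∀ (i : Fin m) → ∑ k (λ j → λs j * vs j i) ≈ 0#) → ∀ j → λs j ≈ 0#

  column : {m n : ℕ} → (Fin m → Fin n → Carrier) → Fin n → Fin m → Carrier
  column M j i = M i j

  HasRank : {m n : ℕ} → (Fin m → Fin n → Carrier) → ℕ → Set (c ⊔ ℓ)
  HasRank {m} {n} M r =
    (Σ (Fin r → Fin n) λ cs → LinIndep (λ j → column M (cs j)))
    × (∀ (cs : Fin (suc r) → Fin n) → ¬ LinIndep (λ j → column M (cs j)))

-- A symmetric matrix of rank one has all its 2 × 2 minors zero. If row u has
-- a nonzero entry Ω u w, the minor on rows and columns {u, w} gives
-- Ω u u · Ω w w = Ω u w · Ω w u ≠ 0, so Ω u u ≠ 0; the minor on {u, v} then gives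
-- Ω u v · Ω v u = Ω u u · Ω v v ≠ 0. Off the diagonal Ω u v = -ω(uv), so uv is
-- an edge with nonzero stress. Over a field with undecidable equality the
-- vanishing of a minor is only available doubly negated, which suffices since
-- every conclusion drawn from it is itself a negation.
module Submission where

open import Defs
open import Level using (Level; _⊔_)
open import Data.Nat using (ℕ)
open import Data.Fin using (Fin; zero; suc; _≟_)
open import Data.Bool using (true; false)
open import Data.Product using (_×_; _,_; ∃)
open import Data.Vec.Functional using ([]; _∷_)
open import Relation.Nullary using (¬_; yes; no; contradiction)
open import Relation.Nullary.Negation using (¬¬-map)
open import Relation.Binary.PropositionalEquality using (_≡_; _≢_; refl; ≢-sym; subst)
  renaming (trans to ≡-trans; sym to ≡-sym)
import Algebra.Properties.Ring as RingProperties
import Algebra.Properties.CommutativeSemigroup as CommutativeSemigroupProperties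
import Relation.Binary.Reasoning.Setoid as SetoidReasoning

module FieldProperties {c ℓ : Level} (K : Field c ℓ) where
  open Field K hiding (zero)
  open RingProperties ring using (x[y-z]≈xy-xz; +-cancelʳ; x∙y⁻¹≈ε⇒x≈y; -‿injective; -0#≈0#)
  open CommutativeSemigroupProperties *-commutativeSemigroup using (x∙yz≈y∙xz; x∙yz≈y∙zx)
  open SetoidReasoning setoid

  x*y≈0⇒x≈0 : ∀ {x y} → y ≉ 0# → x * y ≈ 0# → x ≈ 0#
  x*y≈0⇒x≈0 {x} {y} y≉0 xy≈0 with inverse y y≉0
  ... | y⁻¹ , yy⁻¹≈1 = begin
    x              ≈⟨ *-identityʳ x ⟨
    x * 1#         ≈⟨ *-congˡ yy⁻¹≈1 ⟨
    x * (y * y⁻¹)  ≈⟨ *-assoc x y y⁻¹ ⟨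
    (x * y) * y⁻¹  ≈⟨ *-congʳ xy≈0 ⟩
    0# * y⁻¹       ≈⟨ zeroˡ y⁻¹ ⟩
    0#             ∎

  *-≉0 : ∀ {x y} → x ≉ 0# → y ≉ 0# → x * y ≉ 0#
  *-≉0 x≉0 y≉0 xy≈0 = x≉0 (x*y≈0⇒x≈0 y≉0 xy≈0)

  x*y≉0⇒x≉0 : ∀ {x y} → x * y ≉ 0# → x ≉ 0#
  x*y≉0⇒x≉0 {x} {y} xy≉0 x≈0 = xy≉0 (trans (*-congʳ x≈0) (zeroˡ y))

  -x≈0⇒x≈0 : ∀ {x} → - x ≈ 0# → x ≈ 0#
  -x≈0⇒x≈0 -x≈0 = -‿injective (trans -x≈0 (sym -0#≈0#))

  x≈0⇒-x≈0 : ∀ {x} → x ≈ 0# → - x ≈ 0#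
  x≈0⇒-x≈0 x≈0 = trans (-‿cong x≈0) -0#≈0#

  ¬¬≈-preserves-≉0 : ∀ {x y} → ¬ ¬ (x ≈ y) → x ≉ 0# → y ≉ 0#
  ¬¬≈-preserves-≉0 ¬¬x≈y x≉0 y≈0 = ¬¬x≈y (λ x≈y → x≉0 (trans x≈y y≈0))

  *-cancelˡ-≉ : ∀ {l x y} → l * x ≈ l * y → x ≉ y → l ≈ 0#
  *-cancelˡ-≉ {l} {x} {y} lx≈ly x≉y = x*y≈0⇒x≈0 x-y≉0 (begin
    l * (x - y)    ≈⟨ x[y-z]≈xy-xz l x y ⟩
    l * x - l * y  ≈⟨ +-congˡ (-‿cong lx≈ly) ⟨
    l * x - l * x  ≈⟨ -‿inverseʳ (l * x) ⟩
    0#             ∎)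
    where
    x-y≉0 : x - y ≉ 0#
    x-y≉0 x-y≈0 = x≉y (x∙y⁻¹≈ε⇒x≈y x y x-y≈0)

  cramer-≈0 : ∀ {a b c e l₀ l₁} → a * e ≉ b * c →
              l₀ * a + l₁ * b ≈ 0# → l₀ * c + l₁ * e ≈ 0# → l₀ ≈ 0#
  cramer-≈0 {a} {b} {c} {e} {l₀} {l₁} ae≉bc row₁ row₂ = *-cancelˡ-≉ l₀ae≈l₀bc ae≉bc
    where
    l₀ae≈l₀bc : l₀ * (a * e) ≈ l₀ * (b * c)
    l₀ae≈l₀bc = +-cancelʳ (l₁ * (b * e)) _ _ (begin
      l₀ * (a * e) + l₁ * (b * e)    ≈⟨ +-cong (x∙yz≈y∙zx e l₀ a) (x∙yz≈y∙zx e l₁ b) ⟨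
      e * (l₀ * a) + e * (l₁ * b)    ≈⟨ distribˡ e (l₀ * a) (l₁ * b) ⟨
      e * (l₀ * a + l₁ * b)          ≈⟨ *-congˡ row₁ ⟩
      e * 0#                         ≈⟨ zeroʳ e ⟩
      0#                             ≈⟨ zeroʳ b ⟨
      b * 0#                         ≈⟨ *-congˡ row₂ ⟨
      b * (l₀ * c + l₁ * e)          ≈⟨ distribˡ b (l₀ * c) (l₁ * e) ⟩
      b * (l₀ * c) + b * (l₁ * e)    ≈⟨ +-cong (x∙yz≈y∙xz b l₀ c) (x∙yz≈y∙xz b l₁ e) ⟩
      l₀ * (b * c) + l₁ * (b * e)    ∎)

module MatrixProperties {c ℓ : Level} (K : Field c ℓ) where
  open Field K hiding (zero)
  open FieldDefs K
  open FieldProperties K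

  Symmetric : ∀ {n} → (Fin n → Fin n → Carrier) → Set ℓ
  Symmetric M = ∀ i j → M i j ≈ M j i

  NoTwoIndependentColumns : ∀ {m n} → (Fin m → Fin n → Carrier) → Set (c ⊔ ℓ)
  NoTwoIndependentColumns M = ∀ (cs : Fin 2 → Fin _) → ¬ LinIndep (λ k → column M (cs k))

  Minors₂Vanish : ∀ {m n} → (Fin m → Fin n → Carrier) → Set ℓ
  Minors₂Vanish M = ∀ i i′ j j′ → ¬ ¬ (M i j * M i′ j′ ≈ M i j′ * M i′ j)

  minor≉0⇒columns-independent : ∀ {m n} (M : Fin m → Fin n → Carrier) i i′ j j′ →
    M i j * M i′ j′ ≉ M i j′ * M i′ j → LinIndep (λ k → column M ((j ∷ j′ ∷ []) k))
  minor≉0⇒columns-independent M i i′ j j′ minor≉0 λs combination≈0 = λs≈0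
    where
    row : ∀ r → λs zero * M r j + λs (suc zero) * M r j′ ≈ 0#
    row r = trans (+-congˡ (sym (+-identityʳ _))) (combination≈0 r)

    λs≈0 : ∀ k → λs k ≈ 0#
    λs≈0 zero       = cramer-≈0 minor≉0 (row i) (row i′)
    λs≈0 (suc zero) = cramer-≈0 (λ eq → minor≉0 (sym eq))
                        (trans (+-comm _ _) (row i)) (trans (+-comm _ _) (row i′))

  noTwoIndependentColumns⇒minors₂Vanish : ∀ {m n} (M : Fin m → Fin n → Carrier) →
    NoTwoIndependentColumns M → Minors₂Vanish M
  noTwoIndependentColumns⇒minors₂Vanish M dependent i i′ j j′ minor≉0 =
    dependent (j ∷ j′ ∷ []) (minor≉0⇒columns-independent M i i′ j j′ minor≉0)

  module _ {n} {M : Fin n → Fin n → Carrier} (symmetric : Symmetric M) (minors : Minors₂Vanish M) where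

    row≉0⇒diagonal≉0 : ∀ u w → M u w ≉ 0# → M u u ≉ 0#
    row≉0⇒diagonal≉0 u w uw≉0 =
      x*y≉0⇒x≉0 (¬¬≈-preserves-≉0 (¬¬-map sym (minors u w u w))
                                 (*-≉0 uw≉0 (λ wu≈0 → uw≉0 (trans (symmetric u w) wu≈0))))

    diagonal≉0⇒entry≉0 : ∀ u v → M u u ≉ 0# → M v v ≉ 0# → M u v ≉ 0#
    diagonal≉0⇒entry≉0 u v uu≉0 vv≉0 =
      x*y≉0⇒x≉0 (¬¬≈-preserves-≉0 (minors u v u v) (*-≉0 uu≉0 vv≉0))

module StressMatrixProperties {c ℓ : Level} (K : Field c ℓ) where
  open Field K hiding (zero) renaming (refl to ≈-refl)
  open FieldDefs K
  open FieldProperties K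
  open MatrixProperties K

  module _ {n : ℕ} (G : Graph n) (ω : EdgeVector G) where
    open Graph G

    Ω : Fin n → Fin n → Carrier
    Ω = stressMatrix G ω

    edgeVal-symmetric : Symmetric (edgeVal G ω)
    edgeVal-symmetric i j with adj i j | adj j i | Graph.symm G i j
    ... | true  | true  | refl = EdgeVector.symm ω i j
    ... | false | false | refl = ≈-refl

    stressMatrix-symmetric : Symmetric Ω
    stressMatrix-symmetric i j with i ≟ j | j ≟ i
    ... | yes refl | yes _   = ≈-refl
    ... | yes i≡j  | no j≢i  = contradiction i≡j (≢-sym j≢i)
    ... | no i≢j   | yes j≡i = contradiction j≡i (≢-sym i≢j)
    ... | no _     | no _    = -‿cong (edgeVal-symmetric i j)

    stressMatrix-offDiagonal : ∀ {i j} → i ≢ j → Ω i j ≈ - edgeVal G ω i j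
    stressMatrix-offDiagonal {i} {j} i≢j with i ≟ j
    ... | yes i≡j = contradiction i≡j i≢j
    ... | no _    = ≈-refl

    edgeVal-onEdge : ∀ {u v} → adj u v ≡ true → edgeVal G ω u v ≡ EdgeVector.val ω u v
    edgeVal-onEdge uv∈E rewrite uv∈E = refl

    edgeVal≉0⇒supportEdge : ∀ {u v} → edgeVal G ω u v ≉ 0# →
                            adj u v ≡ true × EdgeVector.val ω u v ≉ 0#
    edgeVal≉0⇒supportEdge {u} {v} uv≉0 with adj u v
    ... | true  = refl , uv≉0
    ... | false = contradiction ≈-refl uv≉0

    inSupport⇒row≉0 : ∀ u → InSupport G ω u → ∃ λ w → Ω u w ≉ 0#
    inSupport⇒row≉0 u (w , uw∈E , ωuw≉0) = w , Ωuw≉0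
      where
      u≢w : u ≢ w
      u≢w refl = contradiction (≡-trans (≡-sym uw∈E) (irrefl u)) λ ()

      Ωuw≉0 : Ω u w ≉ 0#
      Ωuw≉0 Ωuw≈0 = ωuw≉0 (subst (_≈ 0#) (edgeVal-onEdge uw∈E)
                           (-x≈0⇒x≈0 (trans (sym (stressMatrix-offDiagonal u≢w)) Ωuw≈0)))

    supportVertices-joinedBySupportEdge : NoTwoIndependentColumns Ω →
      ∀ u v → u ≢ v → InSupport G ω u → InSupport G ω v →
      adj u v ≡ true × EdgeVector.val ω u v ≉ 0#
    supportVertices-joinedBySupportEdge dependent u v u≢v u∈supp v∈supp =
      edgeVal≉0⇒supportEdge λ ωuv≈0 →
        Ωuv≉0 (trans (stressMatrix-offDiagonal u≢v) (x≈0⇒-x≈0 ωuv≈0))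
      where
      minors : Minors₂Vanish Ω
      minors = noTwoIndependentColumns⇒minors₂Vanish Ω dependent

      diagonal≉0 : ∀ x → InSupport G ω x → Ω x x ≉ 0#
      diagonal≉0 x x∈supp with w , xw≉0 ← inSupport⇒row≉0 x x∈supp =
        row≉0⇒diagonal≉0 stressMatrix-symmetric minors x w xw≉0

      Ωuv≉0 : Ω u v ≉ 0#
      Ωuv≉0 = diagonal≉0⇒entry≉0 stressMatrix-symmetric minors u v
                (diagonal≉0 u u∈supp) (diagonal≉0 v v∈supp)

lemma3p6 : ∀ {c ℓ : Level} (K : Field c ℓ) →
    let open FieldDefs K in
    ∀ (d n : ℕ) (G : Graph n) (p : Fin n → Fin d → Field.Carrier K) (ω : EdgeVector G) →
      IsStress G p ω →
      HasRank (stressMatrix G ω) 1 →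
      ∀ (u v : Fin n) → u ≢ v → InSupport G ω u → InSupport G ω v →
        (Graph.adj G u v ≡ true) × ¬ (Field._≈_ K (EdgeVector.val ω u v) (Field.0# K))
lemma3p6 K _ _ G _ ω _ (_ , noTwoIndependent) u v =
  StressMatrixProperties.supportVertices-joinedBySupportEdge K G ω noTwoIndependent u v
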